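{- Let $k$ be a nonnegative integer, let $T$ be a $k$-forcing set of a graph $G$ and let $A\subseteq T$. 1) If $A$ is a $k$-forcing set of $T$ in $G$, then $A$ is a $k$-forcing set of $G$. 2) If $A$ is a $k$-power dominating set of $T$ in $G$, then $A$ is a $k$-power dominating set of $G$.
   Context: Graphs are finite, simple and undirected; $N[S]=\bigcup_{v\in S}(N(v)\cup\{v\})$. For a graph $G=(V,E)$, nonnegative integer $k$ and $A\subseteq V$: $\mathscr F^0_{G,k}(A)=A$, $\mathscr F^{i+1}_{G,k}(A)=\mathscr F^i_{G,k}(A)\cup\bigcup\{N(v): v\in \mathscr F^i_{G,k}(A),\ 1\le |N(v)\setminus \mathscr F^i_{G,k}(A)|\le k\}$; and $\mathscr P^0_{G,k}(A)=N[A]$ with $\mathscr P^{i+1}_{G,k}(A)$ defined by the same rule. $A$ is a $k$-forcing set of $G$ if $\mathscr F^t_{G,k}(A)=V$ for some $t$, and a $k$-power dominating set of $G$ if $\mathscr P^\ell_{G,k}(A)=V$ for some $\ell$. For $A\subseteq Y\subseteq V$, $A$ is a $k$-forcing set of $Y$ in $G$ if $Y\subseteq \mathscr F^t_{G,k}(A)$ for some $t$, and a $k$-power dominating set of $Y$ in $G$ if $Y\subseteq \mathscr P^\ell_{G,k}(A)$ for some $\ell$. -}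

module Defs where

open import Data.Nat using (ℕ; zero; suc; _≤_; _≤ᵇ_)
open import Data.Bool using (Bool; true; false; _∧_; _∨_; if_then_else_)
open import Data.Fin using (Fin)
open import Data.Fin.Subset using (Subset; _∈_; _⊆_; _∩_; _∪_; _─_; ⋃; ∣_∣; ⊤)
open import Data.Vec using (tabulate; lookup)
open import Data.List using (List; map; filter; allFin)
open import Data.Product using (∃; ∃-syntax)
open import Relation.Binary.PropositionalEquality using (_≡_)
open import Relation.Nullary.Decidable using (_×-dec_)
open import Data.Fin.Subset.Properties using (_∈?_)
open import Data.Nat.Properties using (_≤?_)

record Graph (n : ℕ) : Set where
  field
    adj   : Fin n → Fin n → Bool
    sym   : ∀ u v → adj u v ≡ adj v u
    irrefl : ∀ v → adj v v ≡ false
open Graph public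

module _ {n : ℕ} (G : Graph n) where

  N : Fin n → Subset n
  N v = tabulate (adj G v)

  Nclosed : Subset n → Subset n
  Nclosed A = A ∪ ⋃ (map N (filter (λ v → v ∈? A) (allFin n)))

  step : ℕ → Subset n → Subset n
  step k S = S ∪ ⋃ (map N (filter (λ v → (v ∈? S) ×-dec ((1 ≤? ∣ N v ─ S ∣) ×-dec (∣ N v ─ S ∣ ≤? k))) (allFin n)))

  F : ℕ → ℕ → Subset n → Subset n
  F k zero    A = A
  F k (suc i) A = step k (F k i A)

  P : ℕ → ℕ → Subset n → Subset n
  P k zero    A = Nclosed A
  P k (suc i) A = step k (P k i A)

  ForcingSetOf : ℕ → Subset n → Subset n → Set
  ForcingSetOf k A Y = ∃[ t ] (Y ⊆ F k t A)

  PowerDomSetOf : ℕ → Subset n → Subset n → Set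
  PowerDomSetOf k A Y = ∃[ ℓ ] (Y ⊆ P k ℓ A)

  ForcingSet : ℕ → Subset n → Set
  ForcingSet k A = ∃[ t ] (F k t A ≡ ⊤)

  PowerDomSet : ℕ → Subset n → Set
  PowerDomSet k A = ∃[ ℓ ] (P k ℓ A ≡ ⊤)

-- The iteration 𝓕 is monotone in its starting set and 𝓕^i(𝓕^j(A)) = 𝓕^(i+j)(A),
-- 𝓕^i(𝓟^j(A)) = 𝓟^(i+j)(A).  So if T ⊆ 𝓕^j(A) (resp. T ⊆ 𝓟^j(A)) and 𝓕^t(T) = V,
-- then V = 𝓕^t(T) ⊆ 𝓕^(t+j)(A) (resp. 𝓟^(t+j)(A)).
module Submission where

open import Defs hiding (sym)
open import Data.Nat using (ℕ; zero; suc; _+_; _<_; _≤_)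
open import Data.Nat.Properties using (≤-trans; _≤?_)
open import Data.Fin using (Fin)
open import Data.Fin.Subset using (Subset; _∈_; _∉_; _⊆_; _─_; ⋃; ∣_∣; ⊤; ⁅_⁆; inside; outside)
open import Data.Fin.Subset.Properties
  using (_∈?_; ∉⊥; x∈p∪q⁻; p⊆p∪q; q⊆p∪q; x∈p∧x∉q⇒x∈p─q; p─q⊆p; p⊆q⇒∣p∣≤∣q∣; x∈⁅y⁆⇒x≡y; ∣⁅x⁆∣≡1;
         ⊆-trans; ⊆-reflexive; ⊆-antisym; ⊆⊤)
open import Data.Vec using (_∷_; here; there)
open import Data.List using (List; []; _∷_; map; filter; allFin)
import Data.List.Membership.Propositional as List
open import Data.List.Membership.Propositional.Properties using (∈-allFin; ∈-map∘filter⁻; ∈-map∘filter⁺)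
import Data.List.Relation.Unary.Any as List
open import Data.Product using (_×_; _,_; ∃-syntax)
open import Data.Sum using (_⊎_; inj₁; inj₂)
open import Relation.Nullary using (contradiction; yes; no)
open import Relation.Nullary.Decidable using (_×-dec_)
open import Relation.Unary using (Decidable)
open import Relation.Binary.PropositionalEquality using (_≡_; refl; sym; cong; subst; module ≡-Reasoning)

private variable n : ℕ

x∈p─q⇒x∉q : ∀ {p q : Subset n} {x} → x ∈ p ─ q → x ∉ q
x∈p─q⇒x∉q {p = inside ∷ p} {outside ∷ q} here       ()
x∈p─q⇒x∉q {p = _      ∷ p} {_       ∷ q} (there x∈) (there x∈q) = x∈p─q⇒x∉q x∈ x∈q

p─r⊆p─q : ∀ (p : Subset n) {q r} → q ⊆ r → p ─ r ⊆ p ─ q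
p─r⊆p─q p {q} {r} q⊆r x∈p─r =
  x∈p∧x∉q⇒x∈p─q (p─q⊆p p r x∈p─r) (λ x∈q → x∈p─q⇒x∉q x∈p─r (q⊆r x∈q))

x∈p⇒0<∣p∣ : ∀ {p : Subset n} {x} → x ∈ p → 0 < ∣ p ∣
x∈p⇒0<∣p∣ {p = p} {x} x∈p = subst (_≤ ∣ p ∣) (∣⁅x⁆∣≡1 x) (p⊆q⇒∣p∣≤∣q∣ ⁅x⁆⊆p)
  where
  ⁅x⁆⊆p : ⁅ x ⁆ ⊆ p
  ⁅x⁆⊆p y∈⁅x⁆ = subst (_∈ p) (sym (x∈⁅y⁆⇒x≡y x y∈⁅x⁆)) x∈p

x∈⋃⁻ : ∀ (ps : List (Subset n)) {x} → x ∈ ⋃ ps → ∃[ p ] p List.∈ ps × x ∈ p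
x∈⋃⁻ []       x∈⋃ = contradiction x∈⋃ ∉⊥
x∈⋃⁻ (p ∷ ps) x∈⋃ with x∈p∪q⁻ p (⋃ ps) x∈⋃
... | inj₁ x∈p   = p , List.here refl , x∈p
... | inj₂ x∈⋃ps with x∈⋃⁻ ps x∈⋃ps
...   | q , q∈ps , x∈q = q , List.there q∈ps , x∈q

x∈⋃⁺ : ∀ {ps : List (Subset n)} {p x} → p List.∈ ps → x ∈ p → x ∈ ⋃ ps
x∈⋃⁺              (List.here refl)  x∈p = p⊆p∪q _ x∈p
x∈⋃⁺ {ps = q ∷ _} (List.there p∈ps) x∈p = q⊆p∪q q _ (x∈⋃⁺ p∈ps x∈p)

module _ (G : Graph n) (k : ℕ) where

  CanForce : Subset n → Fin n → Set
  CanForce S v = v ∈ S × (1 ≤ ∣ N G v ─ S ∣ × ∣ N G v ─ S ∣ ≤ k)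

  canForce? : ∀ S → Decidable (CanForce S)
  canForce? S v = (v ∈? S) ×-dec ((1 ≤? ∣ N G v ─ S ∣) ×-dec (∣ N G v ─ S ∣ ≤? k))

  ∈-step⁻ : ∀ {S x} → x ∈ step G k S → x ∈ S ⊎ ∃[ v ] CanForce S v × x ∈ N G v
  ∈-step⁻ {S} x∈ with x∈p∪q⁻ S _ x∈
  ... | inj₁ x∈S = inj₁ x∈S
  ... | inj₂ x∈⋃ with x∈⋃⁻ (map (N G) (filter (canForce? S) (allFin n))) x∈⋃
  ...   | _ , Nv∈ , x∈Nv with ∈-map∘filter⁻ (N G) (canForce? S) {f = N G} {xs = allFin n} Nv∈
  ...     | v , _ , refl , v-forces = inj₂ (v , v-forces , x∈Nv)

  ∈-step⁺ : ∀ {S v x} → CanForce S v → x ∈ N G v → x ∈ step G k S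
  ∈-step⁺ {S} {v} v-forces x∈Nv =
    q⊆p∪q S _ (x∈⋃⁺ (∈-map∘filter⁺ (N G) (canForce? S) {f = N G} (v , ∈-allFin v , refl , v-forces)) x∈Nv)

  -- A neighbour x of a forcing vertex of S is either already in S', or witnesses that
  -- N(v) ─ S' is nonempty, while N(v) ─ S' ⊆ N(v) ─ S keeps at most k vertices.
  step-mono : ∀ {S S'} → S ⊆ S' → step G k S ⊆ step G k S'
  step-mono {S} {S'} S⊆S' {x} x∈ with ∈-step⁻ x∈
  ... | inj₁ x∈S = p⊆p∪q _ (S⊆S' x∈S)
  ... | inj₂ (v , (v∈S , _ , ∣Nv─S∣≤k) , x∈Nv) with x ∈? S'
  ...   | yes x∈S' = p⊆p∪q _ x∈S'
  ...   | no  x∉S' = ∈-step⁺ (S⊆S' v∈S , 0<∣Nv─S'∣ , ∣Nv─S'∣≤k) x∈Nv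
    where
    0<∣Nv─S'∣ : 0 < ∣ N G v ─ S' ∣
    0<∣Nv─S'∣ = x∈p⇒0<∣p∣ (x∈p∧x∉q⇒x∈p─q x∈Nv x∉S')
    ∣Nv─S'∣≤k : ∣ N G v ─ S' ∣ ≤ k
    ∣Nv─S'∣≤k = ≤-trans (p⊆q⇒∣p∣≤∣q∣ (p─r⊆p─q (N G v) S⊆S')) ∣Nv─S∣≤k

  F-mono : ∀ i {S S'} → S ⊆ S' → F G k i S ⊆ F G k i S'
  F-mono zero    S⊆S' = S⊆S'
  F-mono (suc i) S⊆S' = step-mono (F-mono i S⊆S')

  -- Both i ↦ 𝓕^i(A) and i ↦ 𝓟^i(A) are step orbits, definitionally.
  StepOrbit : (ℕ → Subset n) → Set
  StepOrbit X = ∀ i → X (suc i) ≡ step G k (X i)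

  F-orbit : ∀ {X} → StepOrbit X → ∀ i j → F G k i (X j) ≡ X (i + j)
  F-orbit X-orbit zero    j = refl
  F-orbit {X} X-orbit (suc i) j = begin
    step G k (F G k i (X j))  ≡⟨ cong (step G k) (F-orbit X-orbit i j) ⟩
    step G k (X (i + j))      ≡⟨ sym (X-orbit (i + j)) ⟩
    X (suc i + j)             ∎
    where open ≡-Reasoning

  orbit-covering-forcing-set-is-full : ∀ {T} → ForcingSet G k T →
    (X : ℕ → Subset n) → StepOrbit X → ∃[ j ] T ⊆ X j → ∃[ i ] X i ≡ ⊤
  orbit-covering-forcing-set-is-full (t , FtT≡⊤) X X-orbit (j , T⊆Xj) =
    t + j , ⊆-antisym ⊆⊤ ⊤⊆X[t+j]
    where
    ⊤⊆X[t+j] : ⊤ ⊆ X (t + j)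
    ⊤⊆X[t+j] = ⊆-trans (⊆-reflexive (sym FtT≡⊤))
                 (⊆-trans (F-mono t T⊆Xj) (⊆-reflexive (F-orbit X-orbit t j)))

lemma3p6 : {n : ℕ} (G : Graph n) (k : ℕ) (T A : Subset n) →
    ForcingSet G k T → A ⊆ T →
    (ForcingSetOf G k A T → ForcingSet G k A) × (PowerDomSetOf G k A T → PowerDomSet G k A)
lemma3p6 G k T A T-forcing _ =
    orbit-covering-forcing-set-is-full G k T-forcing (λ i → F G k i A) (λ _ → refl)
  , orbit-covering-forcing-set-is-full G k T-forcing (λ i → P G k i A) (λ _ → refl)
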